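{- Let $j \ge 0$ be an integer and define the hyperharmonic polynomials \[ H_{j+1}^{(x)} = \frac{1}{(j+1)!} \sum_{s=0}^{j} (s+1) \genfrac{[}{]}{0pt}{}{j+1}{s+1} x^s , \] and $H_{j+1}^{(x+1)}$ as this polynomial evaluated at $x+1$. Then for every integer $0 \le i \le j$, \[ \frac{d^{i}}{d x^i}H_{j+1}^{(x)} = \frac{(i+1)!}{(j+1)!} \sum_{t=0}^{j-i} \binom{i+t+1}{i+1} \genfrac{[}{]}{0pt}{}{j+1}{i+t+1} x^t, \qquad \frac{d^{i}}{d x^i}H_{j+1}^{(x+1)} = \frac{(i+1)!}{(j+1)!} \sum_{t=0}^{j-i} \binom{i+t+1}{i+1} \genfrac{[}{]}{0pt}{}{j+2}{i+t+2} x^t . \] Consequently, for every integer $r \ge 0$, \[ \left. \frac{d^{i}}{d x^i}H_{j+1}^{(x)}\right|_{x =r} = \frac{(i+1)!}{(j+1)!} \genfrac{[}{]}{0pt}{}{j+r+1}{i+r+1}_r, \qquad \left. \frac{d^{i}}{d x^i}H_{j+1}^{(x+1)}\right|_{x =r} = \frac{(i+1)!}{(j+1)!} \genfrac{[}{]}{0pt}{}{j+r+2}{i+r+2}_{r+1}. \]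
   Context: $\genfrac{[}{]}{0pt}{}{a}{b}$ denotes the unsigned Stirling number of the first kind (number of permutations of $\{1,\dots,a\}$ with exactly $b$ cycles). For an integer $r\ge 0$, $\genfrac{[}{]}{0pt}{}{a}{b}_{r}$ denotes the $r$-Stirling number of the first kind: the number of permutations of $\{1,\dots,a\}$ having exactly $b$ cycles such that $1,\dots,r$ lie in distinct cycles (for $r=0$ this is the ordinary unsigned Stirling number of the first kind). For a positive integer $n$, $H_{j+1}^{(n)}$ coincides with the hyperharmonic number of order $n$ (defined by $H_k^{(0)}=1/k$ for $k>0$, $H_k^{(r)}=\sum_{t=1}^k H_t^{(r-1)}$). -}

module Defs where

open import Data.Nat as ℕ using (ℕ; zero; suc; _≤ᵇ_; _≡ᵇ_; _!)
open import Data.Nat.Properties using (_!≢0)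
open import Data.Nat.Combinatorics using (_C_)
open import Data.Bool using (Bool; true; false; if_then_else_; _∧_)
open import Data.Integer using (+_)
open import Data.Rational using (ℚ; 0ℚ; 1ℚ; _+_; _*_; _/_)
open import Data.List using (List; []; _∷_; map; upTo)

stirling1 : ℕ → ℕ → ℕ
stirling1 zero    zero    = 1
stirling1 zero    (suc k) = 0
stirling1 (suc n) zero    = 0
stirling1 (suc n) (suc k) = n ℕ.* stirling1 n (suc k) ℕ.+ stirling1 n k

-- r-Stirling numbers of the first kind [a, b]_r (Broder), via the
-- standard characterisation:
--   [a, b]_r = 0                 if a < r
--   [a, b]_r = δ_{b,r}           if a = r
--   [a, b]_r = (a-1)[a-1, b]_r + [a-1, b-1]_r   if a > r.
rBase : ℕ → ℕ → ℕ → ℕ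
rBase r a b = if (a ≡ᵇ r) ∧ (b ≡ᵇ r) then 1 else 0

rStirling1 : ℕ → ℕ → ℕ → ℕ
rStirling1 r zero    b = rBase r zero b
rStirling1 r (suc a) b =
  if suc a ≤ᵇ r then rBase r (suc a) b
  else a ℕ.* rStirling1 r a b ℕ.+ prev b
  where
  prev : ℕ → ℕ
  prev zero    = 0
  prev (suc c) = rStirling1 r a c

-- Polynomials over ℚ as coefficient lists (constant term first)

Poly : Set
Poly = List ℚ

ℕtoℚ : ℕ → ℚ
ℕtoℚ n = (+ n) / 1

coeff : Poly → ℕ → ℚ
coeff []       _       = 0ℚ
coeff (a ∷ p)  zero    = a
coeff (a ∷ p)  (suc t) = coeff p t

eval : Poly → ℚ → ℚ
eval []      x = 0ℚ
eval (a ∷ p) x = a + x * eval p x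

_+ₚ_ : Poly → Poly → Poly
[]      +ₚ q       = q
(a ∷ p) +ₚ []      = a ∷ p
(a ∷ p) +ₚ (b ∷ q) = (a + b) ∷ (p +ₚ q)

mulX+1 : Poly → Poly
mulX+1 p = (0ℚ ∷ p) +ₚ p

-- composition p(x) ↦ p(x + 1)
shift : Poly → Poly
shift []      = []
shift (a ∷ p) = (a ∷ []) +ₚ mulX+1 (shift p)

derivFrom : ℕ → Poly → Poly
derivFrom k []      = []
derivFrom k (a ∷ p) = (ℕtoℚ k * a) ∷ derivFrom (suc k) p

deriv : Poly → Poly
deriv []      = []
deriv (a ∷ p) = derivFrom 1 p

derivN : ℕ → Poly → Poly
derivN zero    p = p
derivN (suc i) p = derivN i (deriv p)

invFact : ℕ → ℚ
invFact n = _/_ (+ 1) (n !) {{ n !≢0 }}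

hyperPoly : ℕ → Poly
hyperPoly j =
  map (λ s → invFact (suc j) * ℕtoℚ (suc s ℕ.* stirling1 (suc j) (suc s)))
      (upTo (suc j))

factRatio : ℕ → ℕ → ℚ
factRatio i j = ℕtoℚ (suc i !) * invFact (suc j)

derivPoly : ℕ → ℕ → Poly
derivPoly j i =
  map (λ t → factRatio i j *
             ℕtoℚ (((suc (i ℕ.+ t)) C (suc i)) ℕ.* stirling1 (suc j) (suc (i ℕ.+ t))))
      (upTo (suc (j ℕ.∸ i)))

derivShiftPoly : ℕ → ℕ → Poly
derivShiftPoly j i =
  map (λ t → factRatio i j *
             ℕtoℚ (((suc (i ℕ.+ t)) C (suc i)) ℕ.* stirling1 (suc (suc j)) (suc (suc (i ℕ.+ t)))))
      (upTo (suc (j ℕ.∸ i)))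

{-# OPTIONS --safe #-}
-- Let R n = x (x + 1) ⋯ (x + n - 1) = Σ_k [n, k] x^k. Then H_{j+1}^{(x)} = R (j + 1)′ / (j + 1)!,
-- so its i-th derivative is a multiple of R (j + 1)^{(i+1)}, and the coefficient of x^t in p^{(m)}
-- is m! C(m + t, m) times that of x^{m+t} in p. Multiplying by a linear factor x + c acts on
-- coefficients by a Stirling-type recurrence; since R n (x + 1) = (x + 1) ⋯ (x + n) and
-- R n (x + r) = (x + r) ⋯ (x + r + n - 1), their coefficients are [n + 1, k + 1] and the
-- r-Stirling numbers [n + r, k + r]_r. The values at x = r then come from Taylor's formula
-- p^{(m)}(r) = m! [x^m] p(x + r).
module Submission where

open import Defs
open import Data.Nat using (ℕ; suc; _+_; _≤_)
open import Data.Rational using (ℚ; _*_)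
open import Data.Product using (_×_)
open import Relation.Binary.PropositionalEquality using (_≡_)

open import Algebra.Bundles using (CommutativeMonoid)
open import Data.Bool using (true; false; if_then_else_; T; _∧_)
open import Data.Bool.Properties using (T-∧)
open import Data.List using ([]; _∷_; map; upTo; applyUpTo)
open import Data.List.Properties using (map-applyUpTo)
open import Data.Nat as ℕ using (zero; _!; _<_; _∸_; _≤ᵇ_; _≡ᵇ_; s≤s)
import Data.Nat.Properties as ℕP
open import Data.Nat.Properties using (_!≢0; _!*_!≢0)
open import Data.Nat.Combinatorics using (_C_; nCk≡n!/k![n-k]!; k![n∸k]!∣n!)
open import Data.Nat.Coprimality using (1-coprimeTo) renaming (sym to coprime-sym)
open import Data.Nat.DivMod using (m/n*n≡m)
open import Data.Product using (_,_; proj₂)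
open import Data.Integer using (+_)
import Data.Integer as ℤ
import Data.Integer.Properties as ℤP
import Data.Rational as ℚ
open import Data.Rational using (0ℚ; 1ℚ)
import Data.Rational.Properties as ℚP
open import Data.Rational.Solver using (module +-*-Solver)
open import Data.Unit using (tt)
open import Function using (id; _∘_)
open import Function.Bundles using (Equivalence)
open import Relation.Binary.Bundles using (Setoid)
open import Relation.Binary.PropositionalEquality
  using (_≢_; refl; sym; trans; cong; cong₂; subst; module ≡-Reasoning)
open import Relation.Nullary using (¬_; contradiction)
import Relation.Binary.Reasoning.Setoid as SetoidReasoning

open +-*-Solver
open import Algebra.Properties.CommutativeSemigroup
  (CommutativeMonoid.commutativeSemigroup ℚP.+-0-commutativeMonoid)
  using () renaming (interchange to +-interchange)

ℕtoℚ-+ : ∀ m n → ℕtoℚ (m + n) ≡ ℕtoℚ m ℚ.+ ℕtoℚ n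
ℕtoℚ-+ m n
  rewrite ℚP.normalize-coprime (coprime-sym (1-coprimeTo m))
        | ℚP.normalize-coprime (coprime-sym (1-coprimeTo n)) =
  cong (ℚ._/ 1) (sym (cong₂ ℤ._+_ (ℤP.*-identityʳ (+ m)) (ℤP.*-identityʳ (+ n))))

ℕtoℚ-* : ∀ m n → ℕtoℚ (m ℕ.* n) ≡ ℕtoℚ m * ℕtoℚ n
ℕtoℚ-* m n
  rewrite ℚP.normalize-coprime (coprime-sym (1-coprimeTo m))
        | ℚP.normalize-coprime (coprime-sym (1-coprimeTo n)) =
  cong (ℚ._/ 1) (sym (ℤP.+◃n≡+n (m ℕ.* n)))

ℕtoℚ-suc : ∀ n → ℕtoℚ (suc n) ≡ ℕtoℚ n ℚ.+ 1ℚ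
ℕtoℚ-suc n = trans (cong ℕtoℚ (ℕP.+-comm 1 n)) (ℕtoℚ-+ n 1)

infix 4 _≈_
record _≈_ (p q : Poly) : Set where
  constructor mk≈
  field at : ∀ t → coeff p t ≡ coeff q t
open _≈_

≈-setoid : Setoid _ _
≈-setoid = record
  { _≈_ = _≈_
  ; isEquivalence = record
    { refl = mk≈ λ _ → refl
    ; sym = λ e → mk≈ λ t → sym (at e t)
    ; trans = λ e f → mk≈ λ t → trans (at e t) (at f t)
    }
  }

open Setoid ≈-setoid public using () renaming (refl to ≈-refl; reflexive to ≈-reflexive; sym to ≈-sym; trans to ≈-trans)
module ≈-Reasoning = SetoidReasoning ≈-setoid

∷-cong : ∀ {a b p q} → a ≡ b → p ≈ q → a ∷ p ≈ b ∷ q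
∷-cong a≡b p≈q = mk≈ λ { zero → a≡b ; (suc t) → at p≈q t }

coeff-+ₚ : ∀ p q t → coeff (p +ₚ q) t ≡ coeff p t ℚ.+ coeff q t
coeff-+ₚ []      q       t       = sym (ℚP.+-identityˡ _)
coeff-+ₚ (a ∷ p) []      t       = sym (ℚP.+-identityʳ _)
coeff-+ₚ (a ∷ p) (b ∷ q) zero    = refl
coeff-+ₚ (a ∷ p) (b ∷ q) (suc t) = coeff-+ₚ p q t

∷-injectiveʳ : ∀ {a b p q} → a ∷ p ≈ b ∷ q → p ≈ q
∷-injectiveʳ a∷p≈b∷q = mk≈ (at a∷p≈b∷q ∘ suc)

∷≈[]⇒≈[] : ∀ {a p} → a ∷ p ≈ [] → p ≈ []
∷≈[]⇒≈[] a∷p≈[] = mk≈ (at a∷p≈[] ∘ suc)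

+ₚ-cong : ∀ {p p′ q q′} → p ≈ p′ → q ≈ q′ → p +ₚ q ≈ p′ +ₚ q′
+ₚ-cong {p} {p′} {q} {q′} p≈p′ q≈q′ = mk≈ λ t → begin
  coeff (p +ₚ q) t            ≡⟨ coeff-+ₚ p q t ⟩
  coeff p t ℚ.+ coeff q t     ≡⟨ cong₂ ℚ._+_ (at p≈p′ t) (at q≈q′ t) ⟩
  coeff p′ t ℚ.+ coeff q′ t   ≡⟨ coeff-+ₚ p′ q′ t ⟨
  coeff (p′ +ₚ q′) t          ∎
  where open ≡-Reasoning

+ₚ-congˡ : ∀ p {q q′} → q ≈ q′ → p +ₚ q ≈ p +ₚ q′
+ₚ-congˡ p = +ₚ-cong {p} ≈-refl

+ₚ-assoc : ∀ p q r → (p +ₚ q) +ₚ r ≈ p +ₚ (q +ₚ r)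
+ₚ-assoc p q r = mk≈ λ t → begin
  coeff ((p +ₚ q) +ₚ r) t                    ≡⟨ trans (coeff-+ₚ (p +ₚ q) r t) (cong (ℚ._+ coeff r t) (coeff-+ₚ p q t)) ⟩
  (coeff p t ℚ.+ coeff q t) ℚ.+ coeff r t    ≡⟨ ℚP.+-assoc (coeff p t) (coeff q t) (coeff r t) ⟩
  coeff p t ℚ.+ (coeff q t ℚ.+ coeff r t)    ≡⟨ trans (coeff-+ₚ p (q +ₚ r) t) (cong (coeff p t ℚ.+_) (coeff-+ₚ q r t)) ⟨
  coeff (p +ₚ (q +ₚ r)) t                    ∎
  where open ≡-Reasoning

0∷[]-+ₚ : ∀ p → (0ℚ ∷ []) +ₚ p ≈ p
0∷[]-+ₚ p = mk≈ λ t → trans (coeff-+ₚ (0ℚ ∷ []) p t) (trans (cong (ℚ._+ coeff p t) (coeff-0∷[] t)) (ℚP.+-identityˡ _))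
  where
  coeff-0∷[] : ∀ t → coeff (0ℚ ∷ []) t ≡ 0ℚ
  coeff-0∷[] zero    = refl
  coeff-0∷[] (suc t) = refl

mulX+1-cong : ∀ {p q} → p ≈ q → mulX+1 p ≈ mulX+1 q
mulX+1-cong p≈q = +ₚ-cong (∷-cong refl p≈q) p≈q

scale : ℚ → Poly → Poly
scale c = map (c *_)

coeff-scale : ∀ c p t → coeff (scale c p) t ≡ c * coeff p t
coeff-scale c []      t       = sym (ℚP.*-zeroʳ c)
coeff-scale c (a ∷ p) zero    = refl
coeff-scale c (a ∷ p) (suc t) = coeff-scale c p t

scale-cong : ∀ c {p q} → p ≈ q → scale c p ≈ scale c q
scale-cong c {p} {q} p≈q = mk≈ λ t →
  trans (coeff-scale c p t) (trans (cong (c *_) (at p≈q t)) (sym (coeff-scale c q t)))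

coeff-derivFrom : ∀ k p t → coeff (derivFrom k p) t ≡ ℕtoℚ (k + t) * coeff p t
coeff-derivFrom k []      t       = sym (ℚP.*-zeroʳ (ℕtoℚ (k + t)))
coeff-derivFrom k (a ∷ p) zero    = cong (λ n → ℕtoℚ n * a) (sym (ℕP.+-identityʳ k))
coeff-derivFrom k (a ∷ p) (suc t) =
  trans (coeff-derivFrom (suc k) p t) (cong (λ n → ℕtoℚ n * coeff p t) (sym (ℕP.+-suc k t)))

coeff-deriv : ∀ p t → coeff (deriv p) t ≡ ℕtoℚ (suc t) * coeff p (suc t)
coeff-deriv []      t = sym (ℚP.*-zeroʳ (ℕtoℚ (suc t)))
coeff-deriv (a ∷ p) t = coeff-derivFrom 1 p t

deriv-cong : ∀ {p q} → p ≈ q → deriv p ≈ deriv q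
deriv-cong {p} {q} p≈q = mk≈ λ t →
  trans (coeff-deriv p t) (trans (cong (ℕtoℚ (suc t) *_) (at p≈q (suc t))) (sym (coeff-deriv q t)))

deriv-+ₚ : ∀ p q → deriv (p +ₚ q) ≈ deriv p +ₚ deriv q
deriv-+ₚ p q = mk≈ λ t → begin
  coeff (deriv (p +ₚ q)) t                              ≡⟨ coeff-deriv (p +ₚ q) t ⟩
  ℕtoℚ (suc t) * coeff (p +ₚ q) (suc t)                 ≡⟨ cong (ℕtoℚ (suc t) *_) (coeff-+ₚ p q (suc t)) ⟩
  ℕtoℚ (suc t) * (coeff p (suc t) ℚ.+ coeff q (suc t))  ≡⟨ ℚP.*-distribˡ-+ (ℕtoℚ (suc t)) (coeff p (suc t)) (coeff q (suc t)) ⟩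
  ℕtoℚ (suc t) * coeff p (suc t) ℚ.+ ℕtoℚ (suc t) * coeff q (suc t)
    ≡⟨ cong₂ ℚ._+_ (coeff-deriv p t) (coeff-deriv q t) ⟨
  coeff (deriv p) t ℚ.+ coeff (deriv q) t               ≡⟨ coeff-+ₚ (deriv p) (deriv q) t ⟨
  coeff (deriv p +ₚ deriv q) t                          ∎
  where open ≡-Reasoning

deriv-∷ : ∀ a p → deriv (a ∷ p) ≈ p +ₚ (0ℚ ∷ deriv p)
deriv-∷ a p = mk≈ λ t → trans (coeff-deriv (a ∷ p) t) (trans (coeff-≡ t) (sym (coeff-+ₚ p (0ℚ ∷ deriv p) t)))
  where
  coeff-≡ : ∀ t → ℕtoℚ (suc t) * coeff p t ≡ coeff p t ℚ.+ coeff (0ℚ ∷ deriv p) t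
  coeff-≡ zero    = trans (ℚP.*-identityˡ (coeff p 0)) (sym (ℚP.+-identityʳ (coeff p 0)))
  coeff-≡ (suc t) = begin
    ℕtoℚ (suc (suc t)) * coeff p (suc t)               ≡⟨ cong (_* coeff p (suc t)) (ℕtoℚ-suc (suc t)) ⟩
    (ℕtoℚ (suc t) ℚ.+ 1ℚ) * coeff p (suc t)            ≡⟨ solve 2 (λ n x → (n :+ con 1ℚ) :* x := x :+ n :* x) refl (ℕtoℚ (suc t)) (coeff p (suc t)) ⟩
    coeff p (suc t) ℚ.+ ℕtoℚ (suc t) * coeff p (suc t) ≡⟨ cong (coeff p (suc t) ℚ.+_) (coeff-deriv p t) ⟨
    coeff p (suc t) ℚ.+ coeff (deriv p) t              ∎
    where open ≡-Reasoning

deriv-mulX+1 : ∀ p → deriv (mulX+1 p) ≈ p +ₚ mulX+1 (deriv p)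
deriv-mulX+1 p = begin
  deriv ((0ℚ ∷ p) +ₚ p)                       ≈⟨ deriv-+ₚ (0ℚ ∷ p) p ⟩
  deriv (0ℚ ∷ p) +ₚ deriv p                   ≈⟨ +ₚ-cong (deriv-∷ 0ℚ p) ≈-refl ⟩
  (p +ₚ (0ℚ ∷ deriv p)) +ₚ deriv p            ≈⟨ +ₚ-assoc p (0ℚ ∷ deriv p) (deriv p) ⟩
  p +ₚ mulX+1 (deriv p)                       ∎
  where open ≈-Reasoning

deriv-const-+ₚ : ∀ a p → deriv ((a ∷ []) +ₚ p) ≡ deriv p
deriv-const-+ₚ a []      = refl
deriv-const-+ₚ a (b ∷ p) = refl

risingFactorial : ℕ → ℕ → ℕ
risingFactorial x zero    = 1
risingFactorial x (suc m) = risingFactorial x m ℕ.* (x + m)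

coeff-derivN : ∀ m p t → coeff (derivN m p) t ≡ ℕtoℚ (risingFactorial (suc t) m) * coeff p (t + m)
coeff-derivN zero    p t = sym (trans (ℚP.*-identityˡ _) (cong (coeff p) (ℕP.+-identityʳ t)))
coeff-derivN (suc m) p t = begin
  coeff (derivN m (deriv p)) t                                   ≡⟨ coeff-derivN m (deriv p) t ⟩
  ℕtoℚ r * coeff (deriv p) (t + m)                               ≡⟨ cong (ℕtoℚ r *_) (coeff-deriv p (t + m)) ⟩
  ℕtoℚ r * (ℕtoℚ (suc (t + m)) * coeff p (suc (t + m)))          ≡⟨ ℚP.*-assoc (ℕtoℚ r) _ _ ⟨
  ℕtoℚ r * ℕtoℚ (suc (t + m)) * coeff p (suc (t + m))
    ≡⟨ cong₂ _*_ (ℕtoℚ-* r (suc (t + m))) (cong (coeff p) (ℕP.+-suc t m)) ⟨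
  ℕtoℚ (r ℕ.* suc (t + m)) * coeff p (t + suc m)                 ∎
  where
  open ≡-Reasoning
  r = risingFactorial (suc t) m

risingFactorial-*-! : ∀ t m → risingFactorial (suc t) m ℕ.* t ! ≡ (t + m) !
risingFactorial-*-! t zero    = trans (ℕP.*-identityˡ (t !)) (cong _! (sym (ℕP.+-identityʳ t)))
risingFactorial-*-! t (suc m) = begin
  r ℕ.* suc (t + m) ℕ.* t !     ≡⟨ cong (ℕ._* t !) (ℕP.*-comm r (suc (t + m))) ⟩
  suc (t + m) ℕ.* r ℕ.* t !     ≡⟨ ℕP.*-assoc (suc (t + m)) r (t !) ⟩
  suc (t + m) ℕ.* (r ℕ.* t !)   ≡⟨ cong (suc (t + m) ℕ.*_) (risingFactorial-*-! t m) ⟩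
  suc (t + m) !                 ≡⟨ cong _! (ℕP.+-suc t m) ⟨
  (t + suc m) !                 ∎
  where
  open ≡-Reasoning
  r = risingFactorial (suc t) m

risingFactorial-1 : ∀ m → risingFactorial 1 m ≡ m !
risingFactorial-1 m = trans (sym (ℕP.*-identityʳ (risingFactorial 1 m))) (risingFactorial-*-! 0 m)

nCk*[k!*[n∸k]!]≡n! : ∀ {n k} → k ≤ n → (n C k) ℕ.* (k ! ℕ.* (n ∸ k) !) ≡ n !
nCk*[k!*[n∸k]!]≡n! {n} {k} k≤n =
  trans (cong (ℕ._* (k ! ℕ.* (n ∸ k) !)) (nCk≡n!/k![n-k]! k≤n))
        (m/n*n≡m {{k !* (n ∸ k) !≢0}} (k![n∸k]!∣n! k≤n))

risingFactorial≡!*C : ∀ t m → risingFactorial (suc t) m ≡ m ! ℕ.* ((m + t) C m)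
risingFactorial≡!*C t m = ℕP.*-cancelʳ-≡ _ _ (t !) {{t !≢0}} (begin
  risingFactorial (suc t) m ℕ.* t !     ≡⟨ risingFactorial-*-! t m ⟩
  (t + m) !                             ≡⟨ cong _! (ℕP.+-comm t m) ⟩
  (m + t) !                             ≡⟨ nCk*[k!*[n∸k]!]≡n! (ℕP.m≤m+n m t) ⟨
  c ℕ.* (m ! ℕ.* (m + t ∸ m) !)         ≡⟨ cong (λ n → c ℕ.* (m ! ℕ.* n !)) (ℕP.m+n∸m≡n m t) ⟩
  c ℕ.* (m ! ℕ.* t !)                   ≡⟨ ℕP.*-assoc c (m !) (t !) ⟨
  c ℕ.* m ! ℕ.* t !                     ≡⟨ cong (ℕ._* t !) (ℕP.*-comm c (m !)) ⟩
  m ! ℕ.* c ℕ.* t !                     ∎)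
  where
  open ≡-Reasoning
  c = (m + t) C m

derivN-cong : ∀ m {p q} → p ≈ q → derivN m p ≈ derivN m q
derivN-cong zero    p≈q = p≈q
derivN-cong (suc m) p≈q = derivN-cong m (deriv-cong p≈q)

derivN-scale : ∀ m c p → derivN m (scale c p) ≈ scale c (derivN m p)
derivN-scale m c p = mk≈ coeff-≡
  where
  coeff-≡ : ∀ t → coeff (derivN m (scale c p)) t ≡ coeff (scale c (derivN m p)) t
  coeff-≡ t = begin
    coeff (derivN m (scale c p)) t       ≡⟨ coeff-derivN m (scale c p) t ⟩
    ℕtoℚ r * coeff (scale c p) (t + m)   ≡⟨ cong (ℕtoℚ r *_) (coeff-scale c p (t + m)) ⟩
    ℕtoℚ r * (c * coeff p (t + m))       ≡⟨ solve 3 (λ r c x → r :* (c :* x) := c :* (r :* x)) refl (ℕtoℚ r) c _ ⟩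
    c * (ℕtoℚ r * coeff p (t + m))       ≡⟨ cong (c *_) (coeff-derivN m p t) ⟨
    c * coeff (derivN m p) t             ≡⟨ coeff-scale c (derivN m p) t ⟨
    coeff (scale c (derivN m p)) t       ∎
    where
    open ≡-Reasoning
    r = risingFactorial (suc t) m

coeff-shift-zero : ∀ a p → coeff (shift (a ∷ p)) 0 ≡ a ℚ.+ coeff (shift p) 0
coeff-shift-zero a p = begin
  coeff (shift (a ∷ p)) 0                                    ≡⟨ coeff-+ₚ (a ∷ []) (mulX+1 (shift p)) 0 ⟩
  a ℚ.+ coeff (mulX+1 (shift p)) 0                           ≡⟨ cong (a ℚ.+_) (coeff-+ₚ (0ℚ ∷ shift p) (shift p) 0) ⟩
  a ℚ.+ (0ℚ ℚ.+ coeff (shift p) 0)                           ≡⟨ cong (a ℚ.+_) (ℚP.+-identityˡ (coeff (shift p) 0)) ⟩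
  a ℚ.+ coeff (shift p) 0                                    ∎
  where open ≡-Reasoning

coeff-shift-suc : ∀ a p t → coeff (shift (a ∷ p)) (suc t) ≡ coeff (shift p) t ℚ.+ coeff (shift p) (suc t)
coeff-shift-suc a p t = begin
  coeff (shift (a ∷ p)) (suc t)                              ≡⟨ coeff-+ₚ (a ∷ []) (mulX+1 (shift p)) (suc t) ⟩
  0ℚ ℚ.+ coeff (mulX+1 (shift p)) (suc t)                    ≡⟨ ℚP.+-identityˡ (coeff (mulX+1 (shift p)) (suc t)) ⟩
  coeff (mulX+1 (shift p)) (suc t)                           ≡⟨ coeff-+ₚ (0ℚ ∷ shift p) (shift p) (suc t) ⟩
  coeff (shift p) t ℚ.+ coeff (shift p) (suc t)              ∎
  where open ≡-Reasoning

shift-+ₚ : ∀ p q → shift (p +ₚ q) ≈ shift p +ₚ shift q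
shift-+ₚ []      q       = ≈-refl
shift-+ₚ (a ∷ p) []      = ≈-sym (mk≈ λ t → trans (coeff-+ₚ (shift (a ∷ p)) [] t) (ℚP.+-identityʳ _))
shift-+ₚ (a ∷ p) (b ∷ q) = mk≈ λ t → trans (coeff-≡ t) (sym (coeff-+ₚ (shift (a ∷ p)) (shift (b ∷ q)) t))
  where
  split : ∀ t → coeff (shift (p +ₚ q)) t ≡ coeff (shift p) t ℚ.+ coeff (shift q) t
  split t = trans (at (shift-+ₚ p q) t) (coeff-+ₚ (shift p) (shift q) t)
  coeff-≡ : ∀ t → coeff (shift ((a ℚ.+ b) ∷ (p +ₚ q))) t ≡ coeff (shift (a ∷ p)) t ℚ.+ coeff (shift (b ∷ q)) t
  coeff-≡ zero = begin
    coeff (shift ((a ℚ.+ b) ∷ (p +ₚ q))) 0                       ≡⟨ coeff-shift-zero (a ℚ.+ b) (p +ₚ q) ⟩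
    (a ℚ.+ b) ℚ.+ coeff (shift (p +ₚ q)) 0                       ≡⟨ cong ((a ℚ.+ b) ℚ.+_) (split 0) ⟩
    (a ℚ.+ b) ℚ.+ (coeff (shift p) 0 ℚ.+ coeff (shift q) 0)      ≡⟨ +-interchange a b _ _ ⟩
    (a ℚ.+ coeff (shift p) 0) ℚ.+ (b ℚ.+ coeff (shift q) 0)      ≡⟨ cong₂ ℚ._+_ (coeff-shift-zero a p) (coeff-shift-zero b q) ⟨
    coeff (shift (a ∷ p)) 0 ℚ.+ coeff (shift (b ∷ q)) 0          ∎
    where open ≡-Reasoning
  coeff-≡ (suc t) = begin
    coeff (shift ((a ℚ.+ b) ∷ (p +ₚ q))) (suc t)                 ≡⟨ coeff-shift-suc (a ℚ.+ b) (p +ₚ q) t ⟩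
    coeff (shift (p +ₚ q)) t ℚ.+ coeff (shift (p +ₚ q)) (suc t)  ≡⟨ cong₂ ℚ._+_ (split t) (split (suc t)) ⟩
    (coeff (shift p) t ℚ.+ coeff (shift q) t) ℚ.+ (coeff (shift p) (suc t) ℚ.+ coeff (shift q) (suc t))
      ≡⟨ +-interchange (coeff (shift p) t) _ _ _ ⟩
    (coeff (shift p) t ℚ.+ coeff (shift p) (suc t)) ℚ.+ (coeff (shift q) t ℚ.+ coeff (shift q) (suc t))
      ≡⟨ cong₂ ℚ._+_ (coeff-shift-suc a p t) (coeff-shift-suc b q t) ⟨
    coeff (shift (a ∷ p)) (suc t) ℚ.+ coeff (shift (b ∷ q)) (suc t)  ∎
    where open ≡-Reasoning

shift-scale : ∀ c p → shift (scale c p) ≈ scale c (shift p)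
shift-scale c []      = ≈-refl
shift-scale c (a ∷ p) = mk≈ λ t → trans (coeff-≡ t) (sym (coeff-scale c (shift (a ∷ p)) t))
  where
  pull : ∀ t → coeff (shift (scale c p)) t ≡ c * coeff (shift p) t
  pull t = trans (at (shift-scale c p) t) (coeff-scale c (shift p) t)
  coeff-≡ : ∀ t → coeff (shift (c * a ∷ scale c p)) t ≡ c * coeff (shift (a ∷ p)) t
  coeff-≡ zero = begin
    coeff (shift (c * a ∷ scale c p)) 0       ≡⟨ coeff-shift-zero (c * a) (scale c p) ⟩
    c * a ℚ.+ coeff (shift (scale c p)) 0     ≡⟨ cong (c * a ℚ.+_) (pull 0) ⟩
    c * a ℚ.+ c * coeff (shift p) 0           ≡⟨ ℚP.*-distribˡ-+ c a (coeff (shift p) 0) ⟨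
    c * (a ℚ.+ coeff (shift p) 0)             ≡⟨ cong (c *_) (coeff-shift-zero a p) ⟨
    c * coeff (shift (a ∷ p)) 0               ∎
    where open ≡-Reasoning
  coeff-≡ (suc t) = begin
    coeff (shift (c * a ∷ scale c p)) (suc t)                             ≡⟨ coeff-shift-suc (c * a) (scale c p) t ⟩
    coeff (shift (scale c p)) t ℚ.+ coeff (shift (scale c p)) (suc t)     ≡⟨ cong₂ ℚ._+_ (pull t) (pull (suc t)) ⟩
    c * coeff (shift p) t ℚ.+ c * coeff (shift p) (suc t)                 ≡⟨ ℚP.*-distribˡ-+ c _ _ ⟨
    c * (coeff (shift p) t ℚ.+ coeff (shift p) (suc t))                   ≡⟨ cong (c *_) (coeff-shift-suc a p t) ⟨
    c * coeff (shift (a ∷ p)) (suc t)                                     ∎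
    where open ≡-Reasoning

shift-≈[] : ∀ {p} → p ≈ [] → shift p ≈ []
shift-≈[] {[]}    _    = ≈-refl
shift-≈[] {a ∷ p} p≈[] = begin
  (a ∷ []) +ₚ mulX+1 (shift p)      ≈⟨ +ₚ-cong (∷-cong (at p≈[] 0) ≈-refl) (mulX+1-cong (shift-≈[] (∷≈[]⇒≈[] p≈[]))) ⟩
  (0ℚ ∷ []) +ₚ mulX+1 []            ≈⟨ 0∷[]-+ₚ (mulX+1 []) ⟩
  (0ℚ ∷ []) +ₚ []                   ≈⟨ 0∷[]-+ₚ [] ⟩
  []                                ∎
  where open ≈-Reasoning

shift-cong : ∀ {p q} → p ≈ q → shift p ≈ shift q
shift-cong {[]}    {[]}    _   = ≈-refl
shift-cong {[]}    {b ∷ q} p≈q = ≈-sym (shift-≈[] (≈-sym p≈q))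
shift-cong {a ∷ p} {[]}    p≈q = shift-≈[] p≈q
shift-cong {a ∷ p} {b ∷ q} p≈q =
  +ₚ-cong (∷-cong (at p≈q 0) ≈-refl) (mulX+1-cong (shift-cong (∷-injectiveʳ p≈q)))

shift-0∷ : ∀ p → shift (0ℚ ∷ p) ≈ mulX+1 (shift p)
shift-0∷ p = 0∷[]-+ₚ (mulX+1 (shift p))

shift-deriv : ∀ p → shift (deriv p) ≈ deriv (shift p)
shift-deriv []      = ≈-refl
shift-deriv (a ∷ p) = begin
  shift (deriv (a ∷ p))                   ≈⟨ shift-cong (deriv-∷ a p) ⟩
  shift (p +ₚ (0ℚ ∷ deriv p))             ≈⟨ shift-+ₚ p (0ℚ ∷ deriv p) ⟩
  shift p +ₚ shift (0ℚ ∷ deriv p)         ≈⟨ +ₚ-congˡ (shift p) (shift-0∷ (deriv p)) ⟩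
  shift p +ₚ mulX+1 (shift (deriv p))     ≈⟨ +ₚ-congˡ (shift p) (mulX+1-cong (shift-deriv p)) ⟩
  shift p +ₚ mulX+1 (deriv (shift p))     ≈⟨ deriv-mulX+1 (shift p) ⟨
  deriv (mulX+1 (shift p))                ≡⟨ deriv-const-+ₚ a (mulX+1 (shift p)) ⟨
  deriv (shift (a ∷ p))                   ∎
  where open ≈-Reasoning

derivN-shift : ∀ m p → shift (derivN m p) ≈ derivN m (shift p)
derivN-shift zero    p = ≈-refl
derivN-shift (suc m) p = ≈-trans (derivN-shift m (deriv p)) (derivN-cong m (shift-deriv p))

eval-+ₚ : ∀ p q x → eval (p +ₚ q) x ≡ eval p x ℚ.+ eval q x
eval-+ₚ []      q       x = sym (ℚP.+-identityˡ (eval q x))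
eval-+ₚ (a ∷ p) []      x = sym (ℚP.+-identityʳ (eval (a ∷ p) x))
eval-+ₚ (a ∷ p) (b ∷ q) x = begin
  (a ℚ.+ b) ℚ.+ x * eval (p +ₚ q) x                    ≡⟨ cong (λ v → (a ℚ.+ b) ℚ.+ x * v) (eval-+ₚ p q x) ⟩
  (a ℚ.+ b) ℚ.+ x * (eval p x ℚ.+ eval q x)
    ≡⟨ solve 5 (λ a b x u v → (a :+ b) :+ x :* (u :+ v) := (a :+ x :* u) :+ (b :+ x :* v)) refl a b x (eval p x) (eval q x) ⟩
  (a ℚ.+ x * eval p x) ℚ.+ (b ℚ.+ x * eval q x)        ∎
  where open ≡-Reasoning

eval-≈[] : ∀ {p} x → p ≈ [] → eval p x ≡ 0ℚ
eval-≈[] {[]}    x _    = refl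
eval-≈[] {a ∷ p} x p≈[] = begin
  a ℚ.+ x * eval p x   ≡⟨ cong₂ (λ u v → u ℚ.+ x * v) (at p≈[] 0) (eval-≈[] x (∷≈[]⇒≈[] p≈[])) ⟩
  0ℚ ℚ.+ x * 0ℚ        ≡⟨ solve 1 (λ x → con 0ℚ :+ x :* con 0ℚ := con 0ℚ) refl x ⟩
  0ℚ                   ∎
  where open ≡-Reasoning

eval-cong : ∀ {p q} x → p ≈ q → eval p x ≡ eval q x
eval-cong {[]}    {[]}    x _   = refl
eval-cong {[]}    {b ∷ q} x p≈q = sym (eval-≈[] x (≈-sym p≈q))
eval-cong {a ∷ p} {[]}    x p≈q = eval-≈[] x p≈q
eval-cong {a ∷ p} {b ∷ q} x p≈q = cong₂ (λ u v → u ℚ.+ x * v) (at p≈q 0) (eval-cong x (∷-injectiveʳ p≈q))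

eval-scale : ∀ c p x → eval (scale c p) x ≡ c * eval p x
eval-scale c []      x = sym (ℚP.*-zeroʳ c)
eval-scale c (a ∷ p) x = begin
  c * a ℚ.+ x * eval (scale c p) x   ≡⟨ cong (λ v → c * a ℚ.+ x * v) (eval-scale c p x) ⟩
  c * a ℚ.+ x * (c * eval p x)       ≡⟨ solve 4 (λ c a x v → c :* a :+ x :* (c :* v) := c :* (a :+ x :* v)) refl c a x (eval p x) ⟩
  c * (a ℚ.+ x * eval p x)           ∎
  where open ≡-Reasoning

eval-shift : ∀ p x → eval (shift p) x ≡ eval p (x ℚ.+ 1ℚ)
eval-shift []      x = refl
eval-shift (a ∷ p) x = begin
  eval ((a ∷ []) +ₚ ((0ℚ ∷ shift p) +ₚ shift p)) x
    ≡⟨ trans (eval-+ₚ (a ∷ []) (mulX+1 (shift p)) x) (cong (eval (a ∷ []) x ℚ.+_) (eval-+ₚ (0ℚ ∷ shift p) (shift p) x)) ⟩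
  (a ℚ.+ x * 0ℚ) ℚ.+ ((0ℚ ℚ.+ x * eval (shift p) x) ℚ.+ eval (shift p) x)
    ≡⟨ cong (λ v → (a ℚ.+ x * 0ℚ) ℚ.+ ((0ℚ ℚ.+ x * v) ℚ.+ v)) (eval-shift p x) ⟩
  (a ℚ.+ x * 0ℚ) ℚ.+ ((0ℚ ℚ.+ x * v) ℚ.+ v)
    ≡⟨ solve 3 (λ a x v → (a :+ x :* con 0ℚ) :+ ((con 0ℚ :+ x :* v) :+ v) := a :+ (x :+ con 1ℚ) :* v) refl a x v ⟩
  a ℚ.+ (x ℚ.+ 1ℚ) * v   ∎
  where
  open ≡-Reasoning
  v = eval p (x ℚ.+ 1ℚ)

eval-0ℚ : ∀ p → eval p 0ℚ ≡ coeff p 0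
eval-0ℚ []      = refl
eval-0ℚ (a ∷ p) = trans (cong (a ℚ.+_) (ℚP.*-zeroˡ (eval p 0ℚ))) (ℚP.+-identityʳ a)

shiftN : ℕ → Poly → Poly
shiftN zero    p = p
shiftN (suc r) p = shiftN r (shift p)

shiftN-cong : ∀ r {p q} → p ≈ q → shiftN r p ≈ shiftN r q
shiftN-cong zero    p≈q = p≈q
shiftN-cong (suc r) p≈q = shiftN-cong r (shift-cong p≈q)

eval-shiftN : ∀ r p → eval p (ℕtoℚ r) ≡ eval (shiftN r p) 0ℚ
eval-shiftN zero    p = refl
eval-shiftN (suc r) p = begin
  eval p (ℕtoℚ (suc r))          ≡⟨ cong (eval p) (ℕtoℚ-suc r) ⟩
  eval p (ℕtoℚ r ℚ.+ 1ℚ)         ≡⟨ eval-shift p (ℕtoℚ r) ⟨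
  eval (shift p) (ℕtoℚ r)        ≡⟨ eval-shiftN r (shift p) ⟩
  eval (shiftN r (shift p)) 0ℚ   ∎
  where open ≡-Reasoning

shiftN-derivN : ∀ r m p → shiftN r (derivN m p) ≈ derivN m (shiftN r p)
shiftN-derivN zero    m p = ≈-refl
shiftN-derivN (suc r) m p = ≈-trans (shiftN-cong r (derivN-shift m p)) (shiftN-derivN r m (shift p))

eval-derivN : ∀ m r p → eval (derivN m p) (ℕtoℚ r) ≡ ℕtoℚ (m !) * coeff (shiftN r p) m
eval-derivN m r p = begin
  eval (derivN m p) (ℕtoℚ r)                  ≡⟨ eval-shiftN r (derivN m p) ⟩
  eval (shiftN r (derivN m p)) 0ℚ             ≡⟨ eval-0ℚ (shiftN r (derivN m p)) ⟩
  coeff (shiftN r (derivN m p)) 0             ≡⟨ at (shiftN-derivN r m p) 0 ⟩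
  coeff (derivN m (shiftN r p)) 0             ≡⟨ coeff-derivN m (shiftN r p) 0 ⟩
  ℕtoℚ (risingFactorial 1 m) * coeff (shiftN r p) m   ≡⟨ cong (λ n → ℕtoℚ n * coeff (shiftN r p) m) (risingFactorial-1 m) ⟩
  ℕtoℚ (m !) * coeff (shiftN r p) m           ∎
  where open ≡-Reasoning

mulXPlus : ℚ → Poly → Poly
mulXPlus c p = (0ℚ ∷ p) +ₚ scale c p

coeff-mulXPlus-zero : ∀ c p → coeff (mulXPlus c p) 0 ≡ c * coeff p 0
coeff-mulXPlus-zero c p = trans (coeff-+ₚ (0ℚ ∷ p) (scale c p) 0) (trans (ℚP.+-identityˡ _) (coeff-scale c p 0))

coeff-mulXPlus-suc : ∀ c p t → coeff (mulXPlus c p) (suc t) ≡ coeff p t ℚ.+ c * coeff p (suc t)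
coeff-mulXPlus-suc c p t = trans (coeff-+ₚ (0ℚ ∷ p) (scale c p) (suc t)) (cong (coeff p t ℚ.+_) (coeff-scale c p (suc t)))

mulX+1-+ₚ-scale : ∀ c p → mulX+1 p +ₚ scale c p ≈ mulXPlus (c ℚ.+ 1ℚ) p
mulX+1-+ₚ-scale c p = mk≈ λ t → begin
  coeff (((0ℚ ∷ p) +ₚ p) +ₚ scale c p) t
    ≡⟨ trans (coeff-+ₚ ((0ℚ ∷ p) +ₚ p) (scale c p) t) (cong₂ ℚ._+_ (coeff-+ₚ (0ℚ ∷ p) p t) (coeff-scale c p t)) ⟩
  (coeff (0ℚ ∷ p) t ℚ.+ coeff p t) ℚ.+ c * coeff p t
    ≡⟨ solve 3 (λ x y c → (x :+ y) :+ c :* y := x :+ (c :+ con 1ℚ) :* y) refl (coeff (0ℚ ∷ p) t) (coeff p t) c ⟩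
  coeff (0ℚ ∷ p) t ℚ.+ (c ℚ.+ 1ℚ) * coeff p t
    ≡⟨ trans (coeff-+ₚ (0ℚ ∷ p) (scale (c ℚ.+ 1ℚ) p) t) (cong (coeff (0ℚ ∷ p) t ℚ.+_) (coeff-scale (c ℚ.+ 1ℚ) p t)) ⟨
  coeff (mulXPlus (c ℚ.+ 1ℚ) p) t   ∎
  where open ≡-Reasoning

shift-mulXPlus : ∀ c p → shift (mulXPlus c p) ≈ mulXPlus (c ℚ.+ 1ℚ) (shift p)
shift-mulXPlus c p = begin
  shift ((0ℚ ∷ p) +ₚ scale c p)             ≈⟨ shift-+ₚ (0ℚ ∷ p) (scale c p) ⟩
  shift (0ℚ ∷ p) +ₚ shift (scale c p)       ≈⟨ +ₚ-cong (shift-0∷ p) (shift-scale c p) ⟩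
  mulX+1 (shift p) +ₚ scale c (shift p)     ≈⟨ mulX+1-+ₚ-scale c (shift p) ⟩
  mulXPlus (c ℚ.+ 1ℚ) (shift p)             ∎
  where open ≈-Reasoning

shiftN-mulXPlus : ∀ r c p → shiftN r (mulXPlus c p) ≈ mulXPlus (c ℚ.+ ℕtoℚ r) (shiftN r p)
shiftN-mulXPlus zero    c p = ≈-reflexive (cong (λ d → mulXPlus d p) (sym (ℚP.+-identityʳ c)))
shiftN-mulXPlus (suc r) c p = begin
  shiftN r (shift (mulXPlus c p))                ≈⟨ shiftN-cong r (shift-mulXPlus c p) ⟩
  shiftN r (mulXPlus (c ℚ.+ 1ℚ) (shift p))       ≈⟨ shiftN-mulXPlus r (c ℚ.+ 1ℚ) (shift p) ⟩
  mulXPlus (c ℚ.+ 1ℚ ℚ.+ ℕtoℚ r) (shiftN r (shift p))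
    ≡⟨ cong (λ d → mulXPlus d (shiftN r (shift p))) (c+1+r≡c+[1+r]) ⟩
  mulXPlus (c ℚ.+ ℕtoℚ (suc r)) (shiftN r (shift p))   ∎
  where
  open ≈-Reasoning
  c+1+r≡c+[1+r] : c ℚ.+ 1ℚ ℚ.+ ℕtoℚ r ≡ c ℚ.+ ℕtoℚ (suc r)
  c+1+r≡c+[1+r] = trans (ℚP.+-assoc c 1ℚ (ℕtoℚ r)) (cong (c ℚ.+_) (trans (ℚP.+-comm 1ℚ (ℕtoℚ r)) (sym (ℕtoℚ-suc r))))

risingFactorialPoly : ℕ → Poly
risingFactorialPoly zero    = 1ℚ ∷ []
risingFactorialPoly (suc n) = mulXPlus (ℕtoℚ n) (risingFactorialPoly n)

coeff-mulXPlus-iterate :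
  (m : ℕ → ℕ) (P : ℕ → Poly) (S : ℕ → ℕ → ℕ) →
  (∀ k → coeff (P 0) k ≡ ℕtoℚ (S 0 k)) →
  (∀ n → P (suc n) ≈ mulXPlus (ℕtoℚ (m n)) (P n)) →
  (∀ n → S (suc n) 0 ≡ m n ℕ.* S n 0) →
  (∀ n k → S (suc n) (suc k) ≡ m n ℕ.* S n (suc k) ℕ.+ S n k) →
  ∀ n k → coeff (P n) k ≡ ℕtoℚ (S n k)
coeff-mulXPlus-iterate m P S base step S-zero S-suc = go
  where
  go : ∀ n k → coeff (P n) k ≡ ℕtoℚ (S n k)
  go zero    k       = base k
  go (suc n) zero    = begin
    coeff (P (suc n)) 0                       ≡⟨ at (step n) 0 ⟩
    coeff (mulXPlus (ℕtoℚ (m n)) (P n)) 0     ≡⟨ coeff-mulXPlus-zero (ℕtoℚ (m n)) (P n) ⟩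
    ℕtoℚ (m n) * coeff (P n) 0                ≡⟨ cong (ℕtoℚ (m n) *_) (go n 0) ⟩
    ℕtoℚ (m n) * ℕtoℚ (S n 0)                 ≡⟨ ℕtoℚ-* (m n) (S n 0) ⟨
    ℕtoℚ (m n ℕ.* S n 0)                      ≡⟨ cong ℕtoℚ (S-zero n) ⟨
    ℕtoℚ (S (suc n) 0)                        ∎
    where open ≡-Reasoning
  go (suc n) (suc k) = begin
    coeff (P (suc n)) (suc k)                                  ≡⟨ at (step n) (suc k) ⟩
    coeff (mulXPlus (ℕtoℚ (m n)) (P n)) (suc k)                ≡⟨ coeff-mulXPlus-suc (ℕtoℚ (m n)) (P n) k ⟩
    coeff (P n) k ℚ.+ ℕtoℚ (m n) * coeff (P n) (suc k)         ≡⟨ cong₂ (λ u v → u ℚ.+ ℕtoℚ (m n) * v) (go n k) (go n (suc k)) ⟩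
    ℕtoℚ (S n k) ℚ.+ ℕtoℚ (m n) * ℕtoℚ (S n (suc k))           ≡⟨ cong (ℕtoℚ (S n k) ℚ.+_) (ℕtoℚ-* (m n) (S n (suc k))) ⟨
    ℕtoℚ (S n k) ℚ.+ ℕtoℚ (m n ℕ.* S n (suc k))                ≡⟨ ℚP.+-comm (ℕtoℚ (S n k)) _ ⟩
    ℕtoℚ (m n ℕ.* S n (suc k)) ℚ.+ ℕtoℚ (S n k)                ≡⟨ ℕtoℚ-+ (m n ℕ.* S n (suc k)) (S n k) ⟨
    ℕtoℚ (m n ℕ.* S n (suc k) ℕ.+ S n k)                       ≡⟨ cong ℕtoℚ (S-suc n k) ⟨
    ℕtoℚ (S (suc n) (suc k))                                   ∎
    where open ≡-Reasoning

shift-const : ∀ a → shift (a ∷ []) ≈ a ∷ []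
shift-const a = ∷-cong (ℚP.+-identityʳ a) ≈-refl

shiftN-const : ∀ r a → shiftN r (a ∷ []) ≈ a ∷ []
shiftN-const zero    a = ≈-refl
shiftN-const (suc r) a = ≈-trans (shiftN-cong r (shift-const a)) (shiftN-const r a)

n*0+0≡0 : ∀ n → n ℕ.* 0 ℕ.+ 0 ≡ 0
n*0+0≡0 n = trans (ℕP.+-identityʳ (n ℕ.* 0)) (ℕP.*-zeroʳ n)

stirling1-vanish : ∀ {n k} → n < k → stirling1 n k ≡ 0
stirling1-vanish {zero}  {suc k} _         = refl
stirling1-vanish {suc n} {suc k} (s≤s n<k) = begin
  n ℕ.* stirling1 n (suc k) ℕ.+ stirling1 n k
    ≡⟨ cong₂ (λ u v → n ℕ.* u ℕ.+ v) (stirling1-vanish (ℕP.m<n⇒m<1+n n<k)) (stirling1-vanish n<k) ⟩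
  n ℕ.* 0 ℕ.+ 0   ≡⟨ n*0+0≡0 n ⟩
  0               ∎
  where open ≡-Reasoning

coeff-risingFactorialPoly : ∀ n k → coeff (risingFactorialPoly n) k ≡ ℕtoℚ (stirling1 n k)
coeff-risingFactorialPoly =
  coeff-mulXPlus-iterate id risingFactorialPoly stirling1 base (λ _ → ≈-refl) S-zero (λ _ _ → refl)
  where
  base : ∀ k → coeff (1ℚ ∷ []) k ≡ ℕtoℚ (stirling1 0 k)
  base zero    = refl
  base (suc k) = refl
  S-zero : ∀ n → stirling1 (suc n) 0 ≡ n ℕ.* stirling1 n 0
  S-zero zero    = refl
  S-zero (suc n) = sym (ℕP.*-zeroʳ (suc n))

coeff-shift-risingFactorialPoly : ∀ n k → coeff (shift (risingFactorialPoly n)) k ≡ ℕtoℚ (stirling1 (suc n) (suc k))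
coeff-shift-risingFactorialPoly =
  coeff-mulXPlus-iterate suc (shift ∘ risingFactorialPoly) (λ n k → stirling1 (suc n) (suc k))
    base step (λ n → ℕP.+-identityʳ _) (λ _ _ → refl)
  where
  base : ∀ k → coeff (shift (1ℚ ∷ [])) k ≡ ℕtoℚ (stirling1 1 (suc k))
  base zero    = at (shift-const 1ℚ) 0
  base (suc k) = at (shift-const 1ℚ) (suc k)
  step : ∀ n → shift (risingFactorialPoly (suc n)) ≈ mulXPlus (ℕtoℚ (suc n)) (shift (risingFactorialPoly n))
  step n = ≈-trans (shift-mulXPlus (ℕtoℚ n) (risingFactorialPoly n))
                   (≈-reflexive (cong (λ c → mulXPlus c (shift (risingFactorialPoly n))) (sym (ℕtoℚ-suc n))))

if-T : ∀ {A : Set} b {x y : A} → T b → (if b then x else y) ≡ x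
if-T true _ = refl

if-¬T : ∀ {A : Set} b {x y : A} → ¬ T b → (if b then x else y) ≡ y
if-¬T false _  = refl
if-¬T true  ¬t = contradiction tt ¬t

if-both : ∀ {A : Set} b {x y z : A} → x ≡ z → y ≡ z → (if b then x else y) ≡ z
if-both true  x≡z _   = x≡z
if-both false _   y≡z = y≡z

rBase-diag : ∀ r → rBase r r r ≡ 1
rBase-diag r = if-T _ (Equivalence.from T-∧ (ℕP.≡⇒≡ᵇ r r refl , ℕP.≡⇒≡ᵇ r r refl))

rBase-≢ : ∀ {r b} a → b ≢ r → rBase r a b ≡ 0
rBase-≢ {r} {b} a b≢r = if-¬T ((a ≡ᵇ r) ∧ (b ≡ᵇ r)) (λ t → b≢r (ℕP.≡ᵇ⇒≡ b r (proj₂ (Equivalence.to T-∧ t))))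

rStirling1-self : ∀ r b → rStirling1 r r b ≡ rBase r r b
rStirling1-self zero    b = refl
rStirling1-self (suc r) b = if-T (suc r ≤ᵇ suc r) (ℕP.≤⇒≤ᵇ (ℕP.≤-refl {suc r}))

suc≰ᵇ : ∀ {r a} → r ≤ a → ¬ T (suc a ≤ᵇ r)
suc≰ᵇ {r} {a} r≤a t = ℕP.<⇒≱ (ℕP.≤ᵇ⇒≤ (suc a) r t) r≤a

rStirling1-suc-zero : ∀ {r a} → r ≤ a → rStirling1 r (suc a) 0 ≡ a ℕ.* rStirling1 r a 0 ℕ.+ 0
rStirling1-suc-zero r≤a = if-¬T _ (suc≰ᵇ r≤a)

rStirling1-suc-suc : ∀ {r a} b → r ≤ a → rStirling1 r (suc a) (suc b) ≡ a ℕ.* rStirling1 r a (suc b) ℕ.+ rStirling1 r a b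
rStirling1-suc-suc b r≤a = if-¬T _ (suc≰ᵇ r≤a)

rStirling1-below : ∀ {r b} a → b < r → rStirling1 r a b ≡ 0
rStirling1-below {r} {b} zero b<r = rBase-≢ 0 (ℕP.<⇒≢ b<r)
rStirling1-below {r} {zero} (suc a) b<r = if-both (suc a ≤ᵇ r) (rBase-≢ (suc a) (ℕP.<⇒≢ b<r))
  (trans (cong (λ n → a ℕ.* n ℕ.+ 0) (rStirling1-below a b<r)) (n*0+0≡0 a))
rStirling1-below {r} {suc b} (suc a) b<r = if-both (suc a ≤ᵇ r) (rBase-≢ (suc a) (ℕP.<⇒≢ b<r))
  (trans (cong₂ (λ n m → a ℕ.* n ℕ.+ m) (rStirling1-below a b<r) (rStirling1-below a (ℕP.<-trans (ℕP.n<1+n b) b<r)))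
         (n*0+0≡0 a))

rStirling1-suc-diag : ∀ {r a} → r ≤ a → rStirling1 r (suc a) r ≡ a ℕ.* rStirling1 r a r
rStirling1-suc-diag {zero}      r≤a = trans (rStirling1-suc-zero r≤a) (ℕP.+-identityʳ _)
rStirling1-suc-diag {suc r} {a} r≤a = begin
  rStirling1 (suc r) (suc a) (suc r)                                     ≡⟨ rStirling1-suc-suc r r≤a ⟩
  a ℕ.* rStirling1 (suc r) a (suc r) ℕ.+ rStirling1 (suc r) a r          ≡⟨ cong (a ℕ.* rStirling1 (suc r) a (suc r) ℕ.+_) (rStirling1-below a (ℕP.n<1+n r)) ⟩
  a ℕ.* rStirling1 (suc r) a (suc r) ℕ.+ 0                               ≡⟨ ℕP.+-identityʳ _ ⟩
  a ℕ.* rStirling1 (suc r) a (suc r)                                     ∎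
  where open ≡-Reasoning

coeff-shiftN-risingFactorialPoly : ∀ r n k →
  coeff (shiftN r (risingFactorialPoly n)) k ≡ ℕtoℚ (rStirling1 r (n + r) (k + r))
coeff-shiftN-risingFactorialPoly r =
  coeff-mulXPlus-iterate (_+ r) (shiftN r ∘ risingFactorialPoly) (λ n k → rStirling1 r (n + r) (k + r))
    base step (λ n → rStirling1-suc-diag (ℕP.m≤n+m r n)) (λ n k → rStirling1-suc-suc (k + r) (ℕP.m≤n+m r n))
  where
  base : ∀ k → coeff (shiftN r (1ℚ ∷ [])) k ≡ ℕtoℚ (rStirling1 r r (k + r))
  base zero    = trans (at (shiftN-const r 1ℚ) 0)
                       (cong ℕtoℚ (sym (trans (rStirling1-self r r) (rBase-diag r))))
  base (suc k) = trans (at (shiftN-const r 1ℚ) (suc k))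
                       (cong ℕtoℚ (sym (trans (rStirling1-self r _) (rBase-≢ {b = suc k + r} r (ℕP.m≢1+n+m r ∘ sym)))))
  step : ∀ n → shiftN r (risingFactorialPoly (suc n)) ≈ mulXPlus (ℕtoℚ (n + r)) (shiftN r (risingFactorialPoly n))
  step n = ≈-trans (shiftN-mulXPlus r (ℕtoℚ n) (risingFactorialPoly n))
                   (≈-reflexive (cong (λ c → mulXPlus c (shiftN r (risingFactorialPoly n))) (sym (ℕtoℚ-+ n r))))

coeff-applyUpTo : ∀ (f : ℕ → ℚ) n → (∀ s → n ≤ s → f s ≡ 0ℚ) → ∀ s → coeff (applyUpTo f n) s ≡ f s
coeff-applyUpTo f zero    f-vanish s       = sym (f-vanish s ℕ.z≤n)
coeff-applyUpTo f (suc n) f-vanish zero    = refl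
coeff-applyUpTo f (suc n) f-vanish (suc s) = coeff-applyUpTo (f ∘ suc) n (λ s n≤s → f-vanish (suc s) (s≤s n≤s)) s

coeff-map-upTo : ∀ (f : ℕ → ℚ) n → (∀ s → n ≤ s → f s ≡ 0ℚ) → ∀ s → coeff (map f (upTo n)) s ≡ f s
coeff-map-upTo f n f-vanish s =
  trans (cong (λ l → coeff l s) (map-applyUpTo id f n)) (coeff-applyUpTo f n f-vanish s)

hyperPoly≈ : ∀ j → hyperPoly j ≈ scale (invFact (suc j)) (deriv (risingFactorialPoly (suc j)))
hyperPoly≈ j = mk≈ λ s → begin
  coeff (hyperPoly j) s                                      ≡⟨ coeff-map-upTo f (suc j) f-vanish s ⟩
  c * ℕtoℚ (suc s ℕ.* stirling1 (suc j) (suc s))             ≡⟨ cong (c *_) (ℕtoℚ-* (suc s) (stirling1 (suc j) (suc s))) ⟩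
  c * (ℕtoℚ (suc s) * ℕtoℚ (stirling1 (suc j) (suc s)))      ≡⟨ cong (λ v → c * (ℕtoℚ (suc s) * v)) (coeff-risingFactorialPoly (suc j) (suc s)) ⟨
  c * (ℕtoℚ (suc s) * coeff R (suc s))                       ≡⟨ cong (c *_) (coeff-deriv R s) ⟨
  c * coeff (deriv R) s                                      ≡⟨ coeff-scale c (deriv R) s ⟨
  coeff (scale c (deriv R)) s                                ∎
  where
  open ≡-Reasoning
  c = invFact (suc j)
  R = risingFactorialPoly (suc j)
  f : ℕ → ℚ
  f s = c * ℕtoℚ (suc s ℕ.* stirling1 (suc j) (suc s))
  f-vanish : ∀ s → suc j ≤ s → f s ≡ 0ℚ
  f-vanish s j<s = begin
    c * ℕtoℚ (suc s ℕ.* stirling1 (suc j) (suc s))   ≡⟨ cong (λ n → c * ℕtoℚ (suc s ℕ.* n)) (stirling1-vanish (s≤s j<s)) ⟩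
    c * ℕtoℚ (suc s ℕ.* 0)                           ≡⟨ cong (λ n → c * ℕtoℚ n) (ℕP.*-zeroʳ (suc s)) ⟩
    c * 0ℚ                                           ≡⟨ ℚP.*-zeroʳ c ⟩
    0ℚ                                               ∎

coeff-derivN-scale-deriv : ∀ i c R t →
  coeff (derivN i (scale c (deriv R))) t
    ≡ (ℕtoℚ (suc i !) * c) * (ℕtoℚ (suc (i + t) C suc i) * coeff R (suc (i + t)))
coeff-derivN-scale-deriv i c R t = begin
  coeff (derivN i (scale c (deriv R))) t                         ≡⟨ at (derivN-scale i c (deriv R)) t ⟩
  coeff (scale c (derivN (suc i) R)) t                           ≡⟨ coeff-scale c (derivN (suc i) R) t ⟩
  c * coeff (derivN (suc i) R) t                                 ≡⟨ cong (c *_) (coeff-derivN (suc i) R t) ⟩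
  c * (ℕtoℚ (risingFactorial (suc t) (suc i)) * coeff R (t + suc i))
    ≡⟨ cong₂ (λ n k → c * (ℕtoℚ n * coeff R k)) (risingFactorial≡!*C t (suc i)) (trans (ℕP.+-suc t i) (cong suc (ℕP.+-comm t i))) ⟩
  c * (ℕtoℚ (suc i ! ℕ.* b) * coeff R (suc (i + t)))             ≡⟨ cong (λ v → c * (v * coeff R (suc (i + t)))) (ℕtoℚ-* (suc i !) b) ⟩
  c * (ℕtoℚ (suc i !) * ℕtoℚ b * coeff R (suc (i + t)))
    ≡⟨ solve 4 (λ c f b x → c :* (f :* b :* x) := (f :* c) :* (b :* x)) refl c (ℕtoℚ (suc i !)) (ℕtoℚ b) (coeff R (suc (i + t))) ⟩
  (ℕtoℚ (suc i !) * c) * (ℕtoℚ b * coeff R (suc (i + t)))        ∎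
  where
  open ≡-Reasoning
  b = suc (i + t) C suc i

-- derivPoly j i and derivShiftPoly j i are the instances St k = [j+1, k+1] and St k = [j+2, k+2].
derivPolyWith : ℕ → ℕ → (ℕ → ℕ) → Poly
derivPolyWith j i St = map (λ t → factRatio i j * ℕtoℚ ((suc (i + t) C suc i) ℕ.* St (i + t))) (upTo (suc (j ∸ i)))

derivN-scale-deriv≈derivPolyWith : ∀ {j i} → i ≤ j → (R : Poly) (St : ℕ → ℕ) →
  (∀ k → coeff R (suc k) ≡ ℕtoℚ (St k)) → (∀ k → j < k → St k ≡ 0) →
  derivN i (scale (invFact (suc j)) (deriv R)) ≈ derivPolyWith j i St
derivN-scale-deriv≈derivPolyWith {j} {i} i≤j R St coeff-R St-vanish = mk≈ λ t → begin
  coeff (derivN i (scale (invFact (suc j)) (deriv R))) t        ≡⟨ coeff-derivN-scale-deriv i (invFact (suc j)) R t ⟩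
  factRatio i j * (ℕtoℚ (b t) * coeff R (suc (i + t)))          ≡⟨ cong (λ v → factRatio i j * (ℕtoℚ (b t) * v)) (coeff-R (i + t)) ⟩
  factRatio i j * (ℕtoℚ (b t) * ℕtoℚ (St (i + t)))              ≡⟨ cong (factRatio i j *_) (ℕtoℚ-* (b t) (St (i + t))) ⟨
  f t                                                           ≡⟨ coeff-map-upTo f (suc (j ∸ i)) f-vanish t ⟨
  coeff (derivPolyWith j i St) t                                ∎
  where
  open ≡-Reasoning
  b : ℕ → ℕ
  b t = suc (i + t) C suc i
  f : ℕ → ℚ
  f t = factRatio i j * ℕtoℚ (b t ℕ.* St (i + t))
  f-vanish : ∀ s → suc (j ∸ i) ≤ s → f s ≡ 0ℚ
  f-vanish s j∸i<s = begin
    factRatio i j * ℕtoℚ (b s ℕ.* St (i + s))   ≡⟨ cong (λ n → factRatio i j * ℕtoℚ (b s ℕ.* n)) (St-vanish (i + s) j<i+s) ⟩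
    factRatio i j * ℕtoℚ (b s ℕ.* 0)            ≡⟨ cong (λ n → factRatio i j * ℕtoℚ n) (ℕP.*-zeroʳ (b s)) ⟩
    factRatio i j * 0ℚ                          ≡⟨ ℚP.*-zeroʳ (factRatio i j) ⟩
    0ℚ                                          ∎
    where
    j<i+s : j < i + s
    j<i+s = subst (_< i + s) (ℕP.m+[n∸m]≡n i≤j) (ℕP.+-monoʳ-< i j∸i<s)

eval-derivN-hyperPoly : ∀ j i r →
  eval (derivN i (hyperPoly j)) (ℕtoℚ r) ≡ factRatio i j * ℕtoℚ (rStirling1 r (suc j + r) (suc i + r))
eval-derivN-hyperPoly j i r = begin
  eval (derivN i (hyperPoly j)) (ℕtoℚ r)                 ≡⟨ eval-cong (ℕtoℚ r) (derivN-cong i (hyperPoly≈ j)) ⟩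
  eval (derivN i (scale c (deriv R))) (ℕtoℚ r)           ≡⟨ eval-cong (ℕtoℚ r) (derivN-scale i c (deriv R)) ⟩
  eval (scale c (derivN (suc i) R)) (ℕtoℚ r)             ≡⟨ eval-scale c (derivN (suc i) R) (ℕtoℚ r) ⟩
  c * eval (derivN (suc i) R) (ℕtoℚ r)                   ≡⟨ cong (c *_) (eval-derivN (suc i) r R) ⟩
  c * (ℕtoℚ (suc i !) * coeff (shiftN r R) (suc i))      ≡⟨ cong (λ v → c * (ℕtoℚ (suc i !) * v)) (coeff-shiftN-risingFactorialPoly r (suc j) (suc i)) ⟩
  c * (ℕtoℚ (suc i !) * v)                               ≡⟨ solve 3 (λ c f v → c :* (f :* v) := (f :* c) :* v) refl c (ℕtoℚ (suc i !)) v ⟩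
  factRatio i j * v                                      ∎
  where
  open ≡-Reasoning
  c = invFact (suc j)
  R = risingFactorialPoly (suc j)
  v = ℕtoℚ (rStirling1 r (suc j + r) (suc i + r))

derivN-hyperPoly≈ : ∀ {j i} → i ≤ j → derivN i (hyperPoly j) ≈ derivPoly j i
derivN-hyperPoly≈ {j} {i} i≤j = ≈-trans (derivN-cong i (hyperPoly≈ j))
  (derivN-scale-deriv≈derivPolyWith i≤j (risingFactorialPoly (suc j)) (λ k → stirling1 (suc j) (suc k))
    (coeff-risingFactorialPoly (suc j) ∘ suc) (λ k j<k → stirling1-vanish (s≤s j<k)))

derivN-shift-hyperPoly≈ : ∀ {j i} → i ≤ j → derivN i (shift (hyperPoly j)) ≈ derivShiftPoly j i
derivN-shift-hyperPoly≈ {j} {i} i≤j = ≈-trans (derivN-cong i shift-H≈)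
  (derivN-scale-deriv≈derivPolyWith i≤j (shift R) (λ k → stirling1 (suc (suc j)) (suc (suc k)))
    (coeff-shift-risingFactorialPoly (suc j) ∘ suc) (λ k j<k → stirling1-vanish (s≤s (s≤s j<k))))
  where
  c = invFact (suc j)
  R = risingFactorialPoly (suc j)
  shift-H≈ : shift (hyperPoly j) ≈ scale c (deriv (shift R))
  shift-H≈ = ≈-trans (shift-cong (hyperPoly≈ j)) (≈-trans (shift-scale c (deriv R)) (scale-cong c (shift-deriv R)))

eval-derivN-shift-hyperPoly : ∀ j i r →
  eval (derivN i (shift (hyperPoly j))) (ℕtoℚ r) ≡ factRatio i j * ℕtoℚ (rStirling1 (suc r) (suc j + suc r) (suc i + suc r))
eval-derivN-shift-hyperPoly j i r = begin
  eval (derivN i (shift H)) (ℕtoℚ r)   ≡⟨ eval-cong (ℕtoℚ r) (derivN-shift i H) ⟨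
  eval (shift (derivN i H)) (ℕtoℚ r)   ≡⟨ eval-shift (derivN i H) (ℕtoℚ r) ⟩
  eval (derivN i H) (ℕtoℚ r ℚ.+ 1ℚ)    ≡⟨ cong (eval (derivN i H)) (ℕtoℚ-suc r) ⟨
  eval (derivN i H) (ℕtoℚ (suc r))     ≡⟨ eval-derivN-hyperPoly j i (suc r) ⟩
  factRatio i j * ℕtoℚ (rStirling1 (suc r) (suc j + suc r) (suc i + suc r)) ∎
  where
  open ≡-Reasoning
  H = hyperPoly j

mainTheorem3 : (j i : ℕ) → i ≤ j →
    ((t : ℕ) → coeff (derivN i (hyperPoly j)) t ≡ coeff (derivPoly j i) t)
    × ((t : ℕ) → coeff (derivN i (shift (hyperPoly j))) t ≡ coeff (derivShiftPoly j i) t)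
    × ((r : ℕ) → eval (derivN i (hyperPoly j)) (ℕtoℚ r)
                   ≡ factRatio i j * ℕtoℚ (rStirling1 r (j + r + 1) (i + r + 1)))
    × ((r : ℕ) → eval (derivN i (shift (hyperPoly j))) (ℕtoℚ r)
                   ≡ factRatio i j * ℕtoℚ (rStirling1 (suc r) (j + r + 2) (i + r + 2)))
mainTheorem3 j i i≤j =
    at (derivN-hyperPoly≈ i≤j)
  , at (derivN-shift-hyperPoly≈ i≤j)
  , (λ r → trans (eval-derivN-hyperPoly j i r) (cong₂ (rStirlingValue r) (+-one j r) (+-one i r)))
  , (λ r → trans (eval-derivN-shift-hyperPoly j i r) (cong₂ (rStirlingValue (suc r)) (+-two j r) (+-two i r)))
  where
  rStirlingValue : ℕ → ℕ → ℕ → ℚ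
  rStirlingValue r a b = factRatio i j * ℕtoℚ (rStirling1 r a b)
  +-one : ∀ n r → suc n + r ≡ n + r + 1
  +-one n r = ℕP.+-comm 1 (n + r)
  +-two : ∀ n r → suc n + suc r ≡ n + r + 2
  +-two n r = trans (cong suc (ℕP.+-suc n r)) (ℕP.+-comm 2 (n + r))
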